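{- For every instance of FZA, the Single Density algorithm outputs a (random) set $F_{\mathrm{ALG}}\subseteq E$ with $\mathbb{E}[\sum_{i}\mathrm{rev}_i(F_{\mathrm{ALG}})]\ge \mathrm{OPT}/\mathcal{O}(\log n)$, where $\mathrm{OPT}$ is the optimal revenue; i.e., it computes an $\mathcal{O}(\log n)$-approximation for FZA in expectation.
   Context: Fare Zone Assignment (FZA): given a tree $T=(V,E)$ with $n=|V|$, a non-decreasing concave function $f\colon\mathbb{N}_0\to\mathbb{R}_{\ge 0}$, and commodities $i\in[k]$, each given by a path $P_i\subseteq E$, a bound $u_i\in\mathbb{N}_0$ and a weight $w_i\in\mathbb{N}$, find $F\subseteq E$ maximizing $\mathrm{rev}(F)=\sum_{i\in[k]}\mathrm{rev}_i(F)$, where $\mathrm{rev}_i(F)=w_i f(|P_i\cap F|)$ if $|P_i\cap F|\le u_i$ and $0$ otherwise. Single Density algorithm: let $d_i=u_i/|P_i|$ (density). Define $M_0=\{i: u_i=0\}$ and, for $j\in\{1,\dots,\lceil\log_2 n\rceil\}$, $M_j=\{i: u_i\ge1,\ d_i\in(2^{ -j},2^{1-j}]\}$. Set $F_0=\emptyset$. Fix an arbitrary root $r\in V$; for an edge $e$ let $\mathrm{dist}(r,e)$ be the number of edges other than $e$ on the unique path from $e$ to $r$. For each $j\ge1$ and each $\theta\in\{0,\dots,2^{j+1}-1\}$ let $F_{j,\theta}=\{e\in E:\mathrm{dist}(r,e)\equiv\theta \bmod 2^{j+1}\}$, and obtain $F_{j,\theta}^{(\mathrm{rand})}$ by deleting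 each edge of $F_{j,\theta}$ independently with probability $1/2$; let $F_j$ be a best (maximum revenue) set among the $F^{(\mathrm{rand})}_{j,\theta}$. The output $F_{\mathrm{ALG}}$ is a best set among $F_0,F_1,\dots,F_{\lceil\log_2 n\rceil}$.
   Formalization: The fare function f takes nonnegative rational values instead of nonnegative real values. -}

module Defs where

open import Data.Nat as ℕ using (ℕ; zero; suc; _%_; _^_; _≡ᵇ_; _<ᵇ_; _≤ᵇ_)
open import Data.Nat.Properties using (m^n≢0)
open import Data.Nat.Logarithm using (⌈log₂_⌉)
open import Data.Fin using (Fin; zero; suc; toℕ; combine)
open import Data.Bool using (Bool; true; false; if_then_else_; _∧_; _xor_)
open import Data.List using (List; []; _∷_)
open import Data.Integer using (+_)
open import Data.Rational using (ℚ; 0ℚ; _+_; _*_; _/_; _⊔_; ½; _≤_)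
open import Relation.Binary.PropositionalEquality using (_≡_; _≢_)

-- A tree with m edges has vertices Fin (suc m) and edges Fin m.
-- `single` is the one-vertex tree; `attach t p` adds a new vertex
-- (labelled zero; old vertices are shifted by suc) joined to the old
-- vertex p by a new edge (labelled zero; old edges shifted by suc).
-- Every finite tree with every choice of root arises this way (up to
-- relabelling); the root is the very first vertex (never re-attached).

data Tree : ℕ → Set where
  single : Tree 0
  attach : ∀ {m} → Tree m → Fin (suc m) → Tree (suc m)

EdgeSet : ℕ → Set
EdgeSet m = Fin m → Bool

∅ : ∀ {m} → EdgeSet m
∅ _ = false

extend : ∀ {m} → Bool → EdgeSet m → EdgeSet (suc m)
extend b F zero    = b
extend b F (suc e) = F e

count : ∀ {m} → EdgeSet m → ℕ
count {zero}  F = 0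
count {suc m} F = (if F zero then 1 else 0) ℕ.+ count (λ e → F (suc e))

_∩_ : ∀ {m} → EdgeSet m → EdgeSet m → EdgeSet m
(F ∩ G) e = F e ∧ G e

rootPath : ∀ {m} → Tree m → Fin (suc m) → EdgeSet m
rootPath single        v       = λ ()
rootPath (attach t p)  zero    = extend true  (rootPath t p)
rootPath (attach t p)  (suc v) = extend false (rootPath t v)

path : ∀ {m} → Tree m → Fin (suc m) → Fin (suc m) → EdgeSet m
path t a b e = rootPath t a e xor rootPath t b e

depth : ∀ {m} → Tree m → Fin (suc m) → ℕ
depth single       _       = 0
depth (attach t p) zero    = suc (depth t p)
depth (attach t p) (suc v) = depth t v

-- dist(r,e): number of edges other than e on the path from e to the root
-- (= depth of the endpoint of e closer to the root).
dist : ∀ {m} → Tree m → Fin m → ℕ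
dist (attach t p) zero    = depth t p
dist (attach t p) (suc e) = dist t e

record FareFunction : Set where
  field
    f          : ℕ → ℚ
    nonneg     : 0ℚ ≤ f 0
    nondecr    : ∀ x → f x ≤ f (suc x)
    concave    : ∀ x → f x + f (suc (suc x)) ≤ f (suc x) + f (suc x)

record Commodity (m : ℕ) : Set where
  field
    src tgt : Fin (suc m)
    src≢tgt : src ≢ tgt
    u       : ℕ
    w       : ℕ
    w≥1     : 1 ℕ.≤ w

record Instance : Set where
  field
    m           : ℕ
    tree        : Tree m
    fare        : FareFunction
    commodities : List (Commodity m)

  n : ℕ
  n = suc m

  open FareFunction fare

  ℕ→ℚ : ℕ → ℚ
  ℕ→ℚ k = + k / 1

  P : Commodity m → EdgeSet m
  P c = path tree (Commodity.src c) (Commodity.tgt c)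

  rev-i : Commodity m → EdgeSet m → ℚ
  rev-i c F =
    let x = count (P c ∩ F) in
    if x ≤ᵇ Commodity.u c then ℕ→ℚ (Commodity.w c) * f x else 0ℚ

  rev : EdgeSet m → ℚ
  rev F = go commodities
    where
    go : List (Commodity m) → ℚ
    go []       = 0ℚ
    go (c ∷ cs) = rev-i c F + go cs

cons : ∀ {N} → Bool → (Fin N → Bool) → (Fin (suc N) → Bool)
cons b ω zero    = b
cons b ω (suc i) = ω i

expect : (N : ℕ) → ((Fin N → Bool) → ℚ) → ℚ
expect zero    g = g (λ ())
expect (suc N) g = ½ * (expect N (λ ω → g (cons true ω)) + expect N (λ ω → g (cons false ω)))

maxFin : (k : ℕ) → (Fin k → ℚ) → ℚ → ℚ
maxFin zero    g d = d
maxFin (suc k) g d = g zero ⊔ maxFin k (λ i → g (suc i)) d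

module SingleDensity (I : Instance) where
  open Instance I

  -- number of density classes j ∈ {1,…,L}
  L : ℕ
  L = ⌈log₂ n ⌉

  -- One fair coin per (j, θ, e); j' : Fin L stands for j = 1 + j',
  -- θ ranges over Fin (2^(L+1)) ⊇ {0,…,2^(j+1)-1}.
  Θ : ℕ
  Θ = 2 ^ suc L

  N : ℕ
  N = (L ℕ.* Θ) ℕ.* m

  Ω : Set
  Ω = Fin N → Bool

  Fjθ : ℕ → ℕ → EdgeSet m
  Fjθ j θ e = _%_ (dist tree e) (2 ^ suc j) ⦃ m^n≢0 2 (suc j) ⦄ ≡ᵇ θ

  Frand : Ω → Fin L → Fin Θ → EdgeSet m
  Frand ω j' θ e = Fjθ (suc (toℕ j')) (toℕ θ) e ∧ ω (combine (combine j' θ) e)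

  -- revenue of a candidate (j,θ); pairs with θ ≥ 2^{j+1} are not
  -- candidates and are replaced by F_0 = ∅ (already a candidate).
  candRev : Ω → Fin L → Fin Θ → ℚ
  candRev ω j' θ =
    if toℕ θ <ᵇ 2 ^ suc (suc (toℕ j')) then rev (Frand ω j' θ) else rev ∅

  -- rev(F_ALG): F_ALG is a best set among F_0, F_1, …, F_L, and
  -- F_j is a best set among the F^{(rand)}_{j,θ}.
  algRev : Ω → ℚ
  algRev ω = maxFin L (λ j' → maxFin Θ (λ θ → candRev ω j' θ) (rev ∅)) (rev ∅)

  expectedAlgRev : ℚ
  expectedAlgRev = expect N algRev

{-# OPTIONS --safe #-}
-- Fix a commodity and let ū = min(u, |P|); no edge set earns more than w·f(ū) from it, and if ū = 0
-- then F₀ = ∅ already earns that much. Otherwise pick the class j with 2^j ū ≤ |P| < 2^(j+1) ū.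
-- The dist-values along a path form two ranges of consecutive integers, so each residue class θ
-- modulo 2^(j+1) meets P in X_θ ≤ ū + 1 edges, and these classes partition P. After the random
-- halving, class θ earns at least w·f(ū)·X_θ/(4ū) in expectation: concavity gives f(k)/k ≥ f(ū)/ū
-- for k ≤ ū, and if X_θ = u + 1, overloading needs two given coins to come up, with probability 1/4.
-- Averaging over θ < 2^(j+1) gives at least w·f(ū)/16. Finally, for every outcome of the coins, the
-- revenue of F₀ plus the θ-averages of all L classes is at most (L + 1) times that of the best set.
module Submission where

open import Defs
open import Data.Nat using (ℕ; suc) renaming (_*_ to _*ℕ_)
open import Data.Nat.Logarithm using (⌈log₂_⌉)
open import Data.Product using (Σ)
open import Data.Integer using (+_)
open import Data.Rational using (ℚ; _*_; _/_; _≤_)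

open import Data.Bool using (Bool; true; false; _∧_; if_then_else_)
import Data.Bool.Properties as Bool
open import Data.Empty using (⊥-elim)
open import Data.Fin using (Fin; zero; suc; toℕ; combine; remQuot; fromℕ<)
open import Data.Nat using (zero)
import Data.Fin.Properties as Fin
open import Data.List using (List; []; _∷_)
import Data.Nat as ℕ
import Data.Nat.Coprimality as ℕ
import Data.Nat.DivMod as ℕ
import Data.Nat.Logarithm as ℕ
import Data.Nat.Properties as ℕ
open import Algebra.Properties.CommutativeSemigroup ℕ.+-commutativeSemigroup
  using () renaming (interchange to +-interchange)
open import Data.Product using (_,_; _×_; proj₂; ∃-syntax)
open import Data.Sum using ([_,_]′)
import Data.Integer as ℤ
import Data.Integer.Properties as ℤ
open import Data.Rational using (mkℚ; _+_; -_; 0ℚ; 1ℚ; ½; Positive; nonNegative)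
import Data.Rational as ℚ
import Data.Rational.Properties as ℚ
open import Data.Rational.Solver renaming (module +-*-Solver to ℚ-Solver)
open import Data.Unit using (tt)
open import Relation.Binary.PropositionalEquality
open import Relation.Nullary using (yes; no)
open import Function using (_∘_; Equivalence)

open ℚ-Solver using (solve; _:+_; _:*_; :-_; _:=_; con)

ℕ→ℚ : ℕ → ℚ
ℕ→ℚ k = + k / 1

private
  ℕ→ℚ≡mkℚ : ∀ k → ℕ→ℚ k ≡ mkℚ (+ k) 0 (ℕ.sym (ℕ.1-coprimeTo k))
  ℕ→ℚ≡mkℚ k = ℚ.↥p/↧p≡p _

ℕ→ℚ-+ : ∀ a b → ℕ→ℚ (a ℕ.+ b) ≡ ℕ→ℚ a + ℕ→ℚ b
ℕ→ℚ-+ a b rewrite ℕ→ℚ≡mkℚ a | ℕ→ℚ≡mkℚ b =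
  trans (ℕ→ℚ≡mkℚ (a ℕ.+ b)) (sym (trans (ℚ./-cong numerator refl) (ℕ→ℚ≡mkℚ (a ℕ.+ b))))
  where
  numerator : + a ℤ.* + 1 ℤ.+ + b ℤ.* + 1 ≡ + (a ℕ.+ b)
  numerator rewrite ℤ.*-identityʳ (+ a) | ℤ.*-identityʳ (+ b) = sym (ℤ.pos-+ a b)

ℕ→ℚ-* : ∀ a b → ℕ→ℚ (a ℕ.* b) ≡ ℕ→ℚ a * ℕ→ℚ b
ℕ→ℚ-* a b rewrite ℕ→ℚ≡mkℚ a | ℕ→ℚ≡mkℚ b =
  trans (ℕ→ℚ≡mkℚ (a ℕ.* b)) (sym (trans (ℚ./-cong (sym (ℤ.pos-* a b)) refl) (ℕ→ℚ≡mkℚ (a ℕ.* b))))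

ℕ→ℚ-mono-≤ : ∀ {a b} → a ℕ.≤ b → ℕ→ℚ a ≤ ℕ→ℚ b
ℕ→ℚ-mono-≤ {a} {b} a≤b rewrite ℕ→ℚ≡mkℚ a | ℕ→ℚ≡mkℚ b =
  ℚ.*≤* (subst₂ ℤ._≤_ (sym (ℤ.*-identityʳ (+ a))) (sym (ℤ.*-identityʳ (+ b))) (ℤ.+≤+ a≤b))

ℕ→ℚ-nonNeg : ∀ k → 0ℚ ≤ ℕ→ℚ k
ℕ→ℚ-nonNeg k = ℕ→ℚ-mono-≤ {0} {k} ℕ.z≤n

ℕ→ℚ-pos : ∀ k → Positive (ℕ→ℚ (suc k))
ℕ→ℚ-pos k = ℚ.normalize-pos (suc k) 1

*-monoˡ-≤ : ∀ {r p q} → 0ℚ ≤ r → p ≤ q → r * p ≤ r * q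
*-monoˡ-≤ {r} 0≤r = ℚ.*-monoˡ-≤-nonNeg r {{nonNegative 0≤r}}

*-nonNeg : ∀ {p q} → 0ℚ ≤ p → 0ℚ ≤ q → 0ℚ ≤ p * q
*-nonNeg {p} {q} 0≤p 0≤q = subst (_≤ p * q) (ℚ.*-zeroʳ p) (*-monoˡ-≤ 0≤p 0≤q)

p≤p+q : ∀ {p q} → 0ℚ ≤ q → p ≤ p + q
p≤p+q {p} {q} 0≤q = subst (_≤ p + q) (ℚ.+-identityʳ p) (ℚ.+-monoʳ-≤ p 0≤q)

p≤q+p : ∀ {p q} → 0ℚ ≤ q → p ≤ q + p
p≤q+p {p} {q} 0≤q = subst (_≤ q + p) (ℚ.+-identityˡ p) (ℚ.+-monoˡ-≤ p 0≤q)

+-cancelˡ-≤ : ∀ r {p q} → r + p ≤ r + q → p ≤ q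
+-cancelˡ-≤ r {p} {q} le = subst₂ _≤_ (cancel p) (cancel q) (ℚ.+-monoʳ-≤ (- r) le)
  where
  cancel : ∀ x → - r + (r + x) ≡ x
  cancel = solve 2 (λ r x → :- r :+ (r :+ x) := x) refl r

*-cancelˡ-≤-ℕ→ℚ : ∀ k {p q} → 1 ℕ.≤ k → ℕ→ℚ k * p ≤ ℕ→ℚ k * q → p ≤ q
*-cancelˡ-≤-ℕ→ℚ (suc k) _ = ℚ.*-cancelˡ-≤-pos (ℕ→ℚ (suc k)) {{ℕ→ℚ-pos k}}

0≤½ : 0ℚ ≤ ½
0≤½ = ℚ.≤ᵇ⇒≤ tt

𝟙 : Bool → ℚ
𝟙 true  = 1ℚ
𝟙 false = 0ℚ

𝟙-nonNeg : ∀ b → 0ℚ ≤ 𝟙 b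
𝟙-nonNeg true  = ℚ.≤ᵇ⇒≤ tt
𝟙-nonNeg false = ℚ.≤-refl

ℕ→ℚ-if : ∀ b → ℕ→ℚ (if b then 1 else 0) ≡ 𝟙 b
ℕ→ℚ-if true  = refl
ℕ→ℚ-if false = refl

expect-cong : ∀ N {g h : (Fin N → Bool) → ℚ} → (∀ ω → g ω ≡ h ω) → expect N g ≡ expect N h
expect-cong zero    g≡h = g≡h _
expect-cong (suc N) g≡h =
  cong₂ (λ x y → ½ * (x + y)) (expect-cong N (g≡h ∘ cons true)) (expect-cong N (g≡h ∘ cons false))

expect-mono : ∀ N {g h : (Fin N → Bool) → ℚ} → (∀ ω → g ω ≤ h ω) → expect N g ≤ expect N h
expect-mono zero    g≤h = g≤h _
expect-mono (suc N) g≤h =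
  *-monoˡ-≤ 0≤½ (ℚ.+-mono-≤ (expect-mono N (g≤h ∘ cons true)) (expect-mono N (g≤h ∘ cons false)))

expect-const : ∀ N q → expect N (λ _ → q) ≡ q
expect-const zero    q = refl
expect-const (suc N) q rewrite expect-const N q = solve 1 (λ q → con ½ :* (q :+ q) := q) refl q

expect-+ : ∀ N (g h : (Fin N → Bool) → ℚ) → expect N (λ ω → g ω + h ω) ≡ expect N g + expect N h
expect-+ zero    g h = refl
expect-+ (suc N) g h
  rewrite expect-+ N (g ∘ cons true) (h ∘ cons true) | expect-+ N (g ∘ cons false) (h ∘ cons false) =
  solve 4 (λ a b c d → con ½ :* ((a :+ b) :+ (c :+ d)) := con ½ :* (a :+ c) :+ con ½ :* (b :+ d)) refl
    (expect N (g ∘ cons true)) (expect N (h ∘ cons true)) (expect N (g ∘ cons false)) (expect N (h ∘ cons false))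

expect-*ˡ : ∀ N q (g : (Fin N → Bool) → ℚ) → expect N (λ ω → q * g ω) ≡ q * expect N g
expect-*ˡ zero    q g = refl
expect-*ˡ (suc N) q g rewrite expect-*ˡ N q (g ∘ cons true) | expect-*ˡ N q (g ∘ cons false) =
  solve 3 (λ q a b → con ½ :* (q :* a :+ q :* b) := q :* (con ½ :* (a :+ b))) refl
    q (expect N (g ∘ cons true)) (expect N (g ∘ cons false))

expect-coin : ∀ N (i : Fin N) → expect N (λ ω → 𝟙 (ω i)) ≡ ½
expect-coin (suc N) zero    = cong₂ (λ x y → ½ * (x + y)) (expect-const N 1ℚ) (expect-const N 0ℚ)
expect-coin (suc N) (suc i) = cong₂ (λ x y → ½ * (x + y)) (expect-coin N i) (expect-coin N i)

expect-coin∧coin : ∀ N {i j : Fin N} → i ≢ j → expect N (λ ω → 𝟙 (ω i ∧ ω j)) ≡ ½ * ½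
expect-coin∧coin (suc N) {zero}  {zero}  i≢j = ⊥-elim (i≢j refl)
expect-coin∧coin (suc N) {zero}  {suc j} i≢j =
  cong₂ (λ x y → ½ * (x + y)) (expect-coin N j) (expect-const N 0ℚ)
expect-coin∧coin (suc N) {suc i} {zero}  i≢j =
  cong₂ (λ x y → ½ * (x + y))
    (trans (expect-cong N (λ ω → cong 𝟙 (Bool.∧-identityʳ (ω i)))) (expect-coin N i))
    (trans (expect-cong N (λ ω → cong 𝟙 (Bool.∧-zeroʳ (ω i)))) (expect-const N 0ℚ))
expect-coin∧coin (suc N) {suc i} {suc j} i≢j =
  cong₂ (λ x y → ½ * (x + y)) (expect-coin∧coin N (i≢j ∘ cong suc)) (expect-coin∧coin N (i≢j ∘ cong suc))

sumFin : (k : ℕ) → (Fin k → ℚ) → ℚ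
sumFin zero    g = 0ℚ
sumFin (suc k) g = g zero + sumFin k (g ∘ suc)

sumFin-cong : ∀ k {g h : Fin k → ℚ} → (∀ i → g i ≡ h i) → sumFin k g ≡ sumFin k h
sumFin-cong zero    g≡h = refl
sumFin-cong (suc k) g≡h = cong₂ _+_ (g≡h zero) (sumFin-cong k (g≡h ∘ suc))

sumFin-mono : ∀ k {g h : Fin k → ℚ} → (∀ i → g i ≤ h i) → sumFin k g ≤ sumFin k h
sumFin-mono zero    g≤h = ℚ.≤-refl
sumFin-mono (suc k) g≤h = ℚ.+-mono-≤ (g≤h zero) (sumFin-mono k (g≤h ∘ suc))

sumFin-zero : ∀ k {g : Fin k → ℚ} → (∀ i → g i ≡ 0ℚ) → sumFin k g ≡ 0ℚ
sumFin-zero zero    g≡0 = refl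
sumFin-zero (suc k) g≡0 rewrite g≡0 zero | sumFin-zero k (g≡0 ∘ suc) = refl

sumFin-nonNeg : ∀ k {g : Fin k → ℚ} → (∀ i → 0ℚ ≤ g i) → 0ℚ ≤ sumFin k g
sumFin-nonNeg zero    0≤g = ℚ.≤-refl
sumFin-nonNeg (suc k) 0≤g = ℚ.+-mono-≤ (0≤g zero) (sumFin-nonNeg k (0≤g ∘ suc))

term≤sumFin : ∀ k {g : Fin k → ℚ} → (∀ i → 0ℚ ≤ g i) → ∀ i → g i ≤ sumFin k g
term≤sumFin (suc k) 0≤g zero    = p≤p+q (sumFin-nonNeg k (0≤g ∘ suc))
term≤sumFin (suc k) 0≤g (suc i) = ℚ.≤-trans (term≤sumFin k (0≤g ∘ suc) i) (p≤q+p (0≤g zero))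

sumFin-*ˡ : ∀ k q (g : Fin k → ℚ) → sumFin k (λ i → q * g i) ≡ q * sumFin k g
sumFin-*ˡ zero    q g = sym (ℚ.*-zeroʳ q)
sumFin-*ˡ (suc k) q g rewrite sumFin-*ˡ k q (g ∘ suc) = sym (ℚ.*-distribˡ-+ q (g zero) (sumFin k (g ∘ suc)))

sumFin-+ : ∀ k (g h : Fin k → ℚ) → sumFin k (λ i → g i + h i) ≡ sumFin k g + sumFin k h
sumFin-+ zero    g h = refl
sumFin-+ (suc k) g h rewrite sumFin-+ k (g ∘ suc) (h ∘ suc) =
  solve 4 (λ a b c d → (a :+ b) :+ (c :+ d) := (a :+ c) :+ (b :+ d)) refl
    (g zero) (h zero) (sumFin k (g ∘ suc)) (sumFin k (h ∘ suc))

sumFin-const : ∀ k q → sumFin k (λ _ → q) ≡ ℕ→ℚ k * q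
sumFin-const zero    q = sym (ℚ.*-zeroˡ q)
sumFin-const (suc k) q rewrite sumFin-const k q | ℕ→ℚ-+ 1 k =
  solve 2 (λ q x → q :+ x :* q := (con 1ℚ :+ x) :* q) refl q (ℕ→ℚ k)

expect-sumFin : ∀ N k (g : Fin k → (Fin N → Bool) → ℚ) →
  expect N (λ ω → sumFin k (λ i → g i ω)) ≡ sumFin k (λ i → expect N (g i))
expect-sumFin N zero    g = expect-const N 0ℚ
expect-sumFin N (suc k) g =
  trans (expect-+ N (g zero) (λ ω → sumFin k (λ i → g (suc i) ω)))
        (cong (λ s → expect N (g zero) + s) (expect-sumFin N k (g ∘ suc)))

sumList : ∀ {A : Set} → List A → (A → ℚ) → ℚ
sumList []       g = 0ℚ
sumList (x ∷ xs) g = g x + sumList xs g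

sumList-mono : ∀ {A : Set} (xs : List A) {g h : A → ℚ} → (∀ x → g x ≤ h x) → sumList xs g ≤ sumList xs h
sumList-mono []       g≤h = ℚ.≤-refl
sumList-mono (x ∷ xs) g≤h = ℚ.+-mono-≤ (g≤h x) (sumList-mono xs g≤h)

sumList-*ˡ : ∀ {A : Set} (xs : List A) q (g : A → ℚ) → sumList xs (λ x → q * g x) ≡ q * sumList xs g
sumList-*ˡ []       q g = sym (ℚ.*-zeroʳ q)
sumList-*ˡ (x ∷ xs) q g rewrite sumList-*ˡ xs q g = sym (ℚ.*-distribˡ-+ q (g x) (sumList xs g))

sumList-+ : ∀ {A : Set} (xs : List A) (g h : A → ℚ) → sumList xs (λ x → g x + h x) ≡ sumList xs g + sumList xs h
sumList-+ []       g h = refl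
sumList-+ (x ∷ xs) g h rewrite sumList-+ xs g h =
  solve 4 (λ a b c d → (a :+ b) :+ (c :+ d) := (a :+ c) :+ (b :+ d)) refl (g x) (h x) (sumList xs g) (sumList xs h)

sumList-sumFin : ∀ {A : Set} (xs : List A) k (g : A → Fin k → ℚ) →
  sumList xs (λ x → sumFin k (g x)) ≡ sumFin k (λ i → sumList xs (λ x → g x i))
sumList-sumFin []       k g = sym (sumFin-zero k (λ _ → refl))
sumList-sumFin (x ∷ xs) k g rewrite sumList-sumFin xs k g = sym (sumFin-+ k (g x) (λ i → sumList xs (λ y → g y i)))

expect-sumList : ∀ {A : Set} N (xs : List A) (g : A → (Fin N → Bool) → ℚ) →
  expect N (λ ω → sumList xs (λ x → g x ω)) ≡ sumList xs (λ x → expect N (g x))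
expect-sumList N []       g = expect-const N 0ℚ
expect-sumList N (x ∷ xs) g =
  trans (expect-+ N (g x) (λ ω → sumList xs (λ y → g y ω))) (cong (λ s → expect N (g x) + s) (expect-sumList N xs g))

count-cong : ∀ {m} {F G : EdgeSet m} → (∀ e → F e ≡ G e) → count F ≡ count G
count-cong {zero}  F≡G = refl
count-cong {suc m} F≡G = cong₂ ℕ._+_ (cong (λ b → if b then 1 else 0) (F≡G zero)) (count-cong (F≡G ∘ suc))

count≤size : ∀ {m} (F : EdgeSet m) → count F ℕ.≤ m
count≤size {zero}  F = ℕ.z≤n
count≤size {suc m} F with F zero
... | true  = ℕ.s≤s (count≤size (F ∘ suc))
... | false = ℕ.m≤n⇒m≤1+n (count≤size (F ∘ suc))

count-∅ : ∀ {m} (F : EdgeSet m) → (∀ e → F e ≡ false) → count F ≡ 0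
count-∅ {zero}  F F≡∅ = refl
count-∅ {suc m} F F≡∅ rewrite F≡∅ zero = count-∅ (F ∘ suc) (F≡∅ ∘ suc)

count-∩-≤ : ∀ {m} (F G : EdgeSet m) → count (F ∩ G) ℕ.≤ count F
count-∩-≤ {zero}  F G = ℕ.z≤n
count-∩-≤ {suc m} F G with F zero | G zero
... | true  | true  = ℕ.s≤s (count-∩-≤ (F ∘ suc) (G ∘ suc))
... | true  | false = ℕ.m≤n⇒m≤1+n (count-∩-≤ (F ∘ suc) (G ∘ suc))
... | false | _     = count-∩-≤ (F ∘ suc) (G ∘ suc)

count-∩-< : ∀ {m} (F G : EdgeSet m) {e} → F e ≡ true → G e ≡ false → count (F ∩ G) ℕ.< count F
count-∩-< {suc m} F G {zero} Fe Ge rewrite Fe | Ge = ℕ.s≤s (count-∩-≤ (F ∘ suc) (G ∘ suc))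
count-∩-< {suc m} F G {suc e} Fe Ge = ℕ.+-mono-≤-< (head (F zero) (G zero)) (count-∩-< (F ∘ suc) (G ∘ suc) Fe Ge)
  where
  head : ∀ a b → (if a ∧ b then 1 else 0) ℕ.≤ (if a then 1 else 0)
  head true  true  = ℕ.≤-refl
  head true  false = ℕ.z≤n
  head false _     = ℕ.z≤n

count-∩-full : ∀ {m} (F G : EdgeSet m) → count F ℕ.≤ count (F ∩ G) → ∀ {e} → F e ≡ true → G e ≡ true
count-∩-full F G full {e} Fe with G e in Ge
... | true  = refl
... | false = ⊥-elim (ℕ.<-irrefl refl (ℕ.<-≤-trans (count-∩-< F G Fe Ge) full))

member : ∀ {m} (F : EdgeSet m) → 1 ℕ.≤ count F → ∃[ e ] F e ≡ true
member {suc m} F 1≤|F| with F zero in F₀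
... | true  = zero , F₀
... | false = let e , Fe = member (F ∘ suc) 1≤|F| in suc e , Fe

two-members : ∀ {m} (F : EdgeSet m) → 2 ℕ.≤ count F → ∃[ e₁ ] ∃[ e₂ ] e₁ ≢ e₂ × F e₁ ≡ true × F e₂ ≡ true
two-members {suc m} F 2≤|F| with F zero in F₀
... | true  = let e , Fe = member (F ∘ suc) (ℕ.≤-pred 2≤|F|) in zero , suc e , (λ ()) , F₀ , Fe
... | false = let e₁ , e₂ , e₁≢e₂ , Fe₁ , Fe₂ = two-members (F ∘ suc) 2≤|F|
              in suc e₁ , suc e₂ , e₁≢e₂ ∘ Fin.suc-injective , Fe₁ , Fe₂

expect-count-thinned : ∀ N {m} (S : EdgeSet m) (coin : Fin m → Fin N) →
  expect N (λ ω → ℕ→ℚ (count (S ∩ (ω ∘ coin)))) ≡ ℕ→ℚ (count S) * ½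
expect-count-thinned N {zero}  S coin = expect-const N 0ℚ
expect-count-thinned N {suc m} S coin =
  begin
    expect N (λ ω → ℕ→ℚ (head ω ℕ.+ count ((S ∘ suc) ∩ (ω ∘ coin ∘ suc))))
  ≡⟨ expect-cong N (λ ω → ℕ→ℚ-+ (head ω) _) ⟩
    expect N (λ ω → ℕ→ℚ (head ω) + ℕ→ℚ (count ((S ∘ suc) ∩ (ω ∘ coin ∘ suc))))
  ≡⟨ expect-+ N _ _ ⟩
    expect N (λ ω → ℕ→ℚ (head ω)) + expect N (λ ω → ℕ→ℚ (count ((S ∘ suc) ∩ (ω ∘ coin ∘ suc))))
  ≡⟨ cong₂ _+_ (expect-head (S zero)) (expect-count-thinned N (S ∘ suc) (coin ∘ suc)) ⟩
    𝟙 (S zero) * ½ + ℕ→ℚ (count (S ∘ suc)) * ½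
  ≡⟨ sym (ℚ.*-distribʳ-+ ½ (𝟙 (S zero)) _) ⟩
    (𝟙 (S zero) + ℕ→ℚ (count (S ∘ suc))) * ½
  ≡⟨ cong (λ x → (x + ℕ→ℚ (count (S ∘ suc))) * ½) (sym (ℕ→ℚ-if (S zero))) ⟩
    (ℕ→ℚ (if S zero then 1 else 0) + ℕ→ℚ (count (S ∘ suc))) * ½
  ≡⟨ cong (_* ½) (sym (ℕ→ℚ-+ (if S zero then 1 else 0) (count (S ∘ suc)))) ⟩
    ℕ→ℚ (count S) * ½
  ∎
  where
  open ≡-Reasoning
  head : (Fin N → Bool) → ℕ
  head ω = if S zero ∧ ω (coin zero) then 1 else 0
  expect-head : ∀ b → expect N (λ ω → ℕ→ℚ (if b ∧ ω (coin zero) then 1 else 0)) ≡ 𝟙 b * ½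
  expect-head true  = trans (expect-cong N (λ ω → ℕ→ℚ-if (ω (coin zero)))) (trans (expect-coin N (coin zero)) (sym (ℚ.*-identityˡ ½)))
  expect-head false = trans (expect-const N 0ℚ) (sym (ℚ.*-zeroˡ ½))

module FareFunctionProperties (fare : FareFunction) where
  open FareFunction fare

  f-nonNeg : ∀ x → 0ℚ ≤ f x
  f-nonNeg zero    = nonneg
  f-nonNeg (suc x) = ℚ.≤-trans (f-nonNeg x) (nondecr x)

  f-mono-≤ : ∀ {x y} → x ℕ.≤ y → f x ≤ f y
  f-mono-≤ = mono ∘ ℕ.≤⇒≤′
    where
    mono : ∀ {x y} → x ℕ.≤′ y → f x ≤ f y
    mono ℕ.≤′-refl     = ℚ.≤-refl
    mono (ℕ.≤′-step p) = ℚ.≤-trans (mono p) (nondecr _)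

  ratio-step : ∀ x → ℕ→ℚ x * f (suc x) ≤ ℕ→ℚ (suc x) * f x
  ratio-step zero = subst₂ _≤_ (sym (ℚ.*-zeroˡ (f 1))) (sym (ℚ.*-identityˡ (f 0))) (f-nonNeg 0)
  ratio-step (suc y) = +-cancelˡ-≤ (ℕ→ℚ y * f (suc y)) (begin
      ℕ→ℚ y * f (suc y) + ℕ→ℚ (suc y) * f (suc (suc y))
    ≤⟨ ℚ.+-monoˡ-≤ _ (ratio-step y) ⟩
      ℕ→ℚ (suc y) * f y + ℕ→ℚ (suc y) * f (suc (suc y))
    ≡⟨ sym (ℚ.*-distribˡ-+ (ℕ→ℚ (suc y)) (f y) _) ⟩
      ℕ→ℚ (suc y) * (f y + f (suc (suc y)))
    ≤⟨ *-monoˡ-≤ (ℕ→ℚ-nonNeg (suc y)) (concave y) ⟩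
      ℕ→ℚ (suc y) * (f (suc y) + f (suc y))
    ≡⟨ regroup ⟩
      ℕ→ℚ y * f (suc y) + ℕ→ℚ (suc (suc y)) * f (suc y)
    ∎)
    where
    open ℚ.≤-Reasoning
    regroup : ℕ→ℚ (suc y) * (f (suc y) + f (suc y)) ≡ ℕ→ℚ y * f (suc y) + ℕ→ℚ (suc (suc y)) * f (suc y)
    regroup rewrite ℕ→ℚ-+ 1 y | ℕ→ℚ-+ 1 (suc y) | ℕ→ℚ-+ 1 y =
      solve 2 (λ z g → (con 1ℚ :+ z) :* (g :+ g) := z :* g :+ (con 1ℚ :+ (con 1ℚ :+ z)) :* g) refl (ℕ→ℚ y) (f (suc y))

  ratio-antitone : ∀ {x y} → x ℕ.≤ y → ℕ→ℚ x * f y ≤ ℕ→ℚ y * f x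
  ratio-antitone = antitone ∘ ℕ.≤⇒≤′
    where
    antitone : ∀ {x y} → x ℕ.≤′ y → ℕ→ℚ x * f y ≤ ℕ→ℚ y * f x
    antitone ℕ.≤′-refl = ℚ.≤-refl
    antitone {x} {suc zero} (ℕ.≤′-step ℕ.≤′-refl) = ratio-step 0
    antitone {x} {suc (suc y)} (ℕ.≤′-step p) = *-cancelˡ-≤-ℕ→ℚ (suc y) (ℕ.s≤s ℕ.z≤n) (begin
        ℕ→ℚ (suc y) * (ℕ→ℚ x * f (suc (suc y)))
      ≡⟨ swap (ℕ→ℚ (suc y)) (ℕ→ℚ x) _ ⟩
        ℕ→ℚ x * (ℕ→ℚ (suc y) * f (suc (suc y)))
      ≤⟨ *-monoˡ-≤ (ℕ→ℚ-nonNeg x) (ratio-step (suc y)) ⟩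
        ℕ→ℚ x * (ℕ→ℚ (suc (suc y)) * f (suc y))
      ≡⟨ swap (ℕ→ℚ x) (ℕ→ℚ (suc (suc y))) _ ⟩
        ℕ→ℚ (suc (suc y)) * (ℕ→ℚ x * f (suc y))
      ≤⟨ *-monoˡ-≤ (ℕ→ℚ-nonNeg (suc (suc y))) (antitone p) ⟩
        ℕ→ℚ (suc (suc y)) * (ℕ→ℚ (suc y) * f x)
      ≡⟨ swap (ℕ→ℚ (suc (suc y))) (ℕ→ℚ (suc y)) (f x) ⟩
        ℕ→ℚ (suc y) * (ℕ→ℚ (suc (suc y)) * f x)
      ∎)
      where
      open ℚ.≤-Reasoning
      swap : ∀ a b c → a * (b * c) ≡ b * (a * c)
      swap = solve 3 (λ a b c → a :* (b :* c) := b :* (a :* c)) refl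

countRange : (ℕ → Bool) → ℕ → ℕ → ℕ
countRange p s zero    = 0
countRange p s (suc k) = countRange p s k ℕ.+ (if p (s ℕ.+ k) then 1 else 0)

countRange-true : ∀ s k → countRange (λ _ → true) s k ≡ k
countRange-true s zero    = refl
countRange-true s (suc k) rewrite countRange-true s k = ℕ.+-comm k 1

-- The dist-values of the edges of a path are the two ranges [top, top + k₁) and [top, top + k₂),
-- where top is the depth of the lowest common ancestor of the endpoints.
record PathProfile {m} (t : Tree m) (a b : Fin (suc m)) : Set where
  field
    top k₁ k₂     : ℕ
    depth-a       : top ℕ.+ k₁ ≡ depth t a
    depth-b       : top ℕ.+ k₂ ≡ depth t b
    count-by-dist : ∀ p → count (path t a b ∩ (p ∘ dist t)) ≡ countRange p top k₁ ℕ.+ countRange p top k₂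

module _ {m} {t : Tree m} where
  open PathProfile

  profile-swap : ∀ {a b} → PathProfile t a b → PathProfile t b a
  profile-swap {a} {b} π = record
    { top = top π ; k₁ = k₂ π ; k₂ = k₁ π ; depth-a = depth-b π ; depth-b = depth-a π
    ; count-by-dist = λ p →
        trans (count-cong (λ e → cong (_∧ p (dist t e)) (Bool.xor-comm (rootPath t b e) (rootPath t a e))))
              (trans (count-by-dist π p) (ℕ.+-comm (countRange p (top π) (k₁ π)) _)) }

  profile-lift : ∀ {a b} q → PathProfile t a b → PathProfile (attach t q) (suc a) (suc b)
  profile-lift q π = record
    { top = top π ; k₁ = k₁ π ; k₂ = k₂ π ; depth-a = depth-a π ; depth-b = depth-b π
    ; count-by-dist = count-by-dist π }

  profile-extend : ∀ {q b} → PathProfile t q b → PathProfile (attach t q) zero (suc b)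
  profile-extend {q} {b} π = record
    { top = top π ; k₁ = suc (k₁ π) ; k₂ = k₂ π
    ; depth-a = trans (ℕ.+-suc (top π) (k₁ π)) (cong suc (depth-a π))
    ; depth-b = depth-b π
    ; count-by-dist = λ p → begin
        new p ℕ.+ count (path t q b ∩ (p ∘ dist t))
      ≡⟨ cong (new p ℕ.+_) (count-by-dist π p) ⟩
        new p ℕ.+ (countRange p (top π) (k₁ π) ℕ.+ countRange p (top π) (k₂ π))
      ≡⟨ trans (sym (ℕ.+-assoc (new p) _ _)) (cong (ℕ._+ countRange p (top π) (k₂ π)) (ℕ.+-comm (new p) _)) ⟩
        (countRange p (top π) (k₁ π) ℕ.+ new p) ℕ.+ countRange p (top π) (k₂ π)
      ≡⟨ cong (λ d → (countRange p (top π) (k₁ π) ℕ.+ (if p d then 1 else 0)) ℕ.+ countRange p (top π) (k₂ π)) (sym (depth-a π)) ⟩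
        countRange p (top π) (suc (k₁ π)) ℕ.+ countRange p (top π) (k₂ π)
      ∎ }
    where
    open ≡-Reasoning
    new : (ℕ → Bool) → ℕ
    new p = if p (depth t q) then 1 else 0

pathProfile : ∀ {m} (t : Tree m) a b → PathProfile t a b
pathProfile single zero zero = record
  { top = 0 ; k₁ = 0 ; k₂ = 0 ; depth-a = refl ; depth-b = refl ; count-by-dist = λ _ → refl }
pathProfile (attach t q) zero zero = record
  { top = suc (depth t q) ; k₁ = 0 ; k₂ = 0 ; depth-a = ℕ.+-identityʳ _ ; depth-b = ℕ.+-identityʳ _
  ; count-by-dist = λ p → count-∅ (path (attach t q) zero zero ∩ (p ∘ dist (attach t q))) λ
      { zero    → refl
      ; (suc e) → cong (_∧ p (dist t e)) (Bool.xor-same (rootPath t q e)) } }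
pathProfile (attach t q) zero    (suc b) = profile-extend (pathProfile t q b)
pathProfile (attach t q) (suc a) zero    = profile-swap (profile-extend (pathProfile t q a))
pathProfile (attach t q) (suc a) (suc b) = profile-lift q (pathProfile t a b)

count-path : ∀ {m} (t : Tree m) a b → let π = pathProfile t a b in
  count (path t a b) ≡ PathProfile.k₁ π ℕ.+ PathProfile.k₂ π
count-path t a b =
  trans (count-cong (λ e → sym (Bool.∧-identityʳ (path t a b e))))
        (trans (count-by-dist (λ _ → true)) (cong₂ ℕ._+_ (countRange-true top k₁) (countRange-true top k₂)))
  where open PathProfile (pathProfile t a b)

hasResidue : (M : ℕ) .{{_ : ℕ.NonZero M}} → ℕ → ℕ → Bool
hasResidue M θ x = x ℕ.% M ℕ.≡ᵇ θ

residue-gap : ∀ M .{{_ : ℕ.NonZero M}} {x y} → x ℕ.% M ≡ y ℕ.% M → x ℕ.< y → x ℕ.+ M ℕ.≤ y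
residue-gap M {x} {y} x≡y x<y = begin
    x ℕ.+ M                                 ≡⟨ cong (ℕ._+ M) (ℕ.m≡m%n+[m/n]*n x M) ⟩
    x ℕ.% M ℕ.+ x ℕ./ M ℕ.* M ℕ.+ M         ≡⟨ ℕ.+-assoc (x ℕ.% M) _ M ⟩
    x ℕ.% M ℕ.+ (x ℕ./ M ℕ.* M ℕ.+ M)       ≡⟨ cong (x ℕ.% M ℕ.+_) (ℕ.+-comm _ M) ⟩
    x ℕ.% M ℕ.+ suc (x ℕ./ M) ℕ.* M         ≤⟨ ℕ.+-monoʳ-≤ (x ℕ.% M) (ℕ.*-monoˡ-≤ M quotient<) ⟩
    x ℕ.% M ℕ.+ y ℕ./ M ℕ.* M               ≡⟨ cong (ℕ._+ y ℕ./ M ℕ.* M) x≡y ⟩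
    y ℕ.% M ℕ.+ y ℕ./ M ℕ.* M               ≡⟨ sym (ℕ.m≡m%n+[m/n]*n y M) ⟩
    y                                       ∎
  where
  open ℕ.≤-Reasoning
  quotient< : x ℕ./ M ℕ.< y ℕ./ M
  quotient< = ℕ.*-cancelʳ-< M _ _ (ℕ.+-cancelˡ-< (x ℕ.% M) _ _
    (subst₂ ℕ._<_ (ℕ.m≡m%n+[m/n]*n x M) (trans (ℕ.m≡m%n+[m/n]*n y M) (cong (ℕ._+ _) (sym x≡y))) x<y))

has-residue : ∀ M .{{_ : ℕ.NonZero M}} {θ x} → hasResidue M θ x ≡ true → x ℕ.% M ≡ θ
has-residue M {θ} {x} hit = ℕ.≡ᵇ⇒≡ (x ℕ.% M) θ (Equivalence.from Bool.T-≡ hit)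

last-hit : ∀ M .{{_ : ℕ.NonZero M}} θ s k → 1 ℕ.≤ countRange (hasResidue M θ) s k →
  ∃[ i ] i ℕ.< k × (s ℕ.+ i) ℕ.% M ≡ θ × M ℕ.* countRange (hasResidue M θ) s k ℕ.≤ i ℕ.+ M
last-hit M θ s (suc k) 1≤hits with hasResidue M θ (s ℕ.+ k) in hit
... | false =
  let i , i<k , hit-i , bound = last-hit M θ s k (subst (1 ℕ.≤_) (ℕ.+-identityʳ _) 1≤hits)
  in i , ℕ.m≤n⇒m≤1+n i<k , hit-i , subst (λ c → M ℕ.* c ℕ.≤ i ℕ.+ M) (sym (ℕ.+-identityʳ _)) bound
... | true with countRange (hasResidue M θ) s k in hits≡
...   | zero  = k , ℕ.n<1+n k , has-residue M hit , ℕ.≤-trans (ℕ.≤-reflexive (ℕ.*-identityʳ M)) (ℕ.m≤n+m M k)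
...   | suc c =
  let i , i<k , hit-i , bound = last-hit M θ s k (subst (1 ℕ.≤_) (sym hits≡) (ℕ.s≤s ℕ.z≤n))
      gap : s ℕ.+ i ℕ.+ M ℕ.≤ s ℕ.+ k
      gap = residue-gap M (trans hit-i (sym (has-residue M hit))) (ℕ.+-monoʳ-< s i<k)
      i+M≤k : i ℕ.+ M ℕ.≤ k
      i+M≤k = ℕ.+-cancelˡ-≤ s _ _ (subst (ℕ._≤ s ℕ.+ k) (ℕ.+-assoc s i M) gap)
  in k , ℕ.n<1+n k , has-residue M hit , (begin
       M ℕ.* (suc c ℕ.+ 1)      ≡⟨ ℕ.*-distribˡ-+ M (suc c) 1 ⟩
       M ℕ.* suc c ℕ.+ M ℕ.* 1  ≡⟨ cong (M ℕ.* suc c ℕ.+_) (ℕ.*-identityʳ M) ⟩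
       M ℕ.* suc c ℕ.+ M        ≤⟨ ℕ.+-monoˡ-≤ M (ℕ.≤-trans (subst (λ h → M ℕ.* h ℕ.≤ i ℕ.+ M) hits≡ bound) i+M≤k) ⟩
       k ℕ.+ M                  ∎)
  where open ℕ.≤-Reasoning

countRange-residue : ∀ M .{{_ : ℕ.NonZero M}} θ s k → M ℕ.* countRange (hasResidue M θ) s k ℕ.< k ℕ.+ M
countRange-residue M θ s k with countRange (hasResidue M θ) s k in hits≡
... | zero  = subst (ℕ._< k ℕ.+ M) (sym (ℕ.*-zeroʳ M)) (ℕ.<-≤-trans (ℕ.n≢0⇒n>0 (ℕ.≢-nonZero⁻¹ M)) (ℕ.m≤n+m M k))
... | suc c = let i , i<k , _ , bound = last-hit M θ s k (subst (1 ℕ.≤_) (sym hits≡) (ℕ.s≤s ℕ.z≤n))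
              in ℕ.≤-<-trans (subst (λ h → M ℕ.* h ℕ.≤ i ℕ.+ M) hits≡ bound) (ℕ.+-monoˡ-< M i<k)

path-residue-count : ∀ {m} (t : Tree m) a b M .{{_ : ℕ.NonZero M}} θ →
  M ℕ.* count (path t a b ∩ (hasResidue M θ ∘ dist t)) ℕ.< count (path t a b) ℕ.+ (M ℕ.+ M)
path-residue-count t a b M θ = begin-strict
    M ℕ.* count (path t a b ∩ (hasResidue M θ ∘ dist t))
  ≡⟨ cong (M ℕ.*_) (count-by-dist (hasResidue M θ)) ⟩
    M ℕ.* (countRange (hasResidue M θ) top k₁ ℕ.+ countRange (hasResidue M θ) top k₂)
  ≡⟨ ℕ.*-distribˡ-+ M _ _ ⟩
    M ℕ.* countRange (hasResidue M θ) top k₁ ℕ.+ M ℕ.* countRange (hasResidue M θ) top k₂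
  <⟨ ℕ.+-mono-< (countRange-residue M θ top k₁) (countRange-residue M θ top k₂) ⟩
    (k₁ ℕ.+ M) ℕ.+ (k₂ ℕ.+ M)
  ≡⟨ +-interchange k₁ M k₂ M ⟩
    (k₁ ℕ.+ k₂) ℕ.+ (M ℕ.+ M)
  ≡⟨ cong (ℕ._+ (M ℕ.+ M)) (sym (count-path t a b)) ⟩
    count (path t a b) ℕ.+ (M ℕ.+ M)
  ∎
  where
  open ℕ.≤-Reasoning
  open PathProfile (pathProfile t a b)

sum-below : ∀ K M → M ℕ.≤ K → sumFin K (λ θ → 𝟙 (toℕ θ ℕ.<ᵇ M)) ≡ ℕ→ℚ M
sum-below zero    zero    _   = refl
sum-below (suc K) zero    _   = trans (cong (λ s → 0ℚ + s) (sumFin-zero K (λ _ → refl))) refl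
sum-below (suc K) (suc M) M≤K = trans (cong (λ s → 1ℚ + s) (sum-below K M (ℕ.≤-pred M≤K))) (sym (ℕ→ℚ-+ 1 M))

sum-below-≡ᵇ : ∀ K M x → x ℕ.< M → M ℕ.≤ K → sumFin K (λ θ → 𝟙 (toℕ θ ℕ.<ᵇ M) * 𝟙 (x ℕ.≡ᵇ toℕ θ)) ≡ 1ℚ
sum-below-≡ᵇ (suc K) (suc M) zero    _   _   = cong (λ s → 1ℚ * 1ℚ + s) (sumFin-zero K (λ θ → ℚ.*-zeroʳ (𝟙 (toℕ θ ℕ.<ᵇ M))))
sum-below-≡ᵇ (suc K) (suc M) (suc x) x<M M≤K = cong (λ s → 1ℚ * 0ℚ + s) (sum-below-≡ᵇ K M x (ℕ.≤-pred x<M) (ℕ.≤-pred M≤K))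

sum-residue-classes : ∀ {m} K M .{{_ : ℕ.NonZero M}} → M ℕ.≤ K → (S : EdgeSet m) (d : Fin m → ℕ) →
  sumFin K (λ θ → 𝟙 (toℕ θ ℕ.<ᵇ M) * ℕ→ℚ (count (S ∩ (hasResidue M (toℕ θ) ∘ d)))) ≡ ℕ→ℚ (count S)
sum-residue-classes {zero}  K M M≤K S d = sumFin-zero K (λ θ → ℚ.*-zeroʳ (𝟙 (toℕ θ ℕ.<ᵇ M)))
sum-residue-classes {suc m} K M M≤K S d =
  begin
    sumFin K (λ θ → below θ * ℕ→ℚ (head θ ℕ.+ tail θ))
  ≡⟨ sumFin-cong K (λ θ → trans (cong (below θ *_) (ℕ→ℚ-+ (head θ) (tail θ))) (ℚ.*-distribˡ-+ (below θ) _ _)) ⟩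
    sumFin K (λ θ → below θ * ℕ→ℚ (head θ) + below θ * ℕ→ℚ (tail θ))
  ≡⟨ sumFin-+ K _ _ ⟩
    sumFin K (λ θ → below θ * ℕ→ℚ (head θ)) + sumFin K (λ θ → below θ * ℕ→ℚ (tail θ))
  ≡⟨ cong₂ _+_ (sum-head (S zero)) (sum-residue-classes K M M≤K (S ∘ suc) (d ∘ suc)) ⟩
    ℕ→ℚ (if S zero then 1 else 0) + ℕ→ℚ (count (S ∘ suc))
  ≡⟨ sym (ℕ→ℚ-+ (if S zero then 1 else 0) (count (S ∘ suc))) ⟩
    ℕ→ℚ (count S)
  ∎
  where
  open ≡-Reasoning
  below : Fin K → ℚ
  below θ = 𝟙 (toℕ θ ℕ.<ᵇ M)
  head tail : Fin K → ℕ
  head θ = if S zero ∧ hasResidue M (toℕ θ) (d zero) then 1 else 0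
  tail θ = count ((S ∘ suc) ∩ (hasResidue M (toℕ θ) ∘ d ∘ suc))
  sum-head : ∀ b → sumFin K (λ θ → below θ * ℕ→ℚ (if b ∧ hasResidue M (toℕ θ) (d zero) then 1 else 0))
                 ≡ ℕ→ℚ (if b then 1 else 0)
  sum-head false = sumFin-zero K (λ θ → ℚ.*-zeroʳ (below θ))
  sum-head true  = trans (sumFin-cong K (λ θ → cong (below θ *_) (ℕ→ℚ-if (hasResidue M (toℕ θ) (d zero)))))
                         (sum-below-≡ᵇ K M (d zero ℕ.% M) (ℕ.m%n<n (d zero) M) M≤K)

⌈log₂1+2^n⌉≡1+n : ∀ n → ⌈log₂ (1 ℕ.+ 2 ℕ.^ n) ⌉ ≡ 1 ℕ.+ n
⌈log₂1+2^n⌉≡1+n zero    = refl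
⌈log₂1+2^n⌉≡1+n (suc n) = pred≡ ⌈log₂ (1 ℕ.+ 2 ℕ.^ suc n) ⌉ (begin
    ⌈log₂ (1 ℕ.+ 2 ℕ.^ suc n) ⌉ ℕ.∸ 1       ≡⟨ sym (ℕ.⌈log₂⌈n/2⌉⌉≡⌈log₂n⌉∸1 (1 ℕ.+ 2 ℕ.^ suc n)) ⟩
    ⌈log₂ ℕ.⌈ 1 ℕ.+ 2 ℕ.^ suc n /2⌉ ⌉       ≡⟨ cong (λ x → ⌈log₂ suc x ⌉) (sym half) ⟩
    ⌈log₂ (1 ℕ.+ 2 ℕ.^ n) ⌉                 ≡⟨ ⌈log₂1+2^n⌉≡1+n n ⟩
    1 ℕ.+ n                                 ∎)
  where
  open ≡-Reasoning
  half : 2 ℕ.^ n ≡ ℕ.⌊ 2 ℕ.^ n ℕ.+ (2 ℕ.^ n ℕ.+ 0) /2⌋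
  half = trans (ℕ.n≡⌊n+n/2⌋ (2 ℕ.^ n)) (cong (λ x → ℕ.⌊ 2 ℕ.^ n ℕ.+ x /2⌋) (sym (ℕ.+-identityʳ _)))
  pred≡ : ∀ x {y} → x ℕ.∸ 1 ≡ suc y → x ≡ suc (suc y)
  pred≡ (suc x) eq = cong suc eq

2^j<n⇒j<⌈log₂n⌉ : ∀ {j n} → 2 ℕ.^ j ℕ.< n → j ℕ.< ⌈log₂ n ⌉
2^j<n⇒j<⌈log₂n⌉ {j} 2^j<n = subst (ℕ._≤ _) (⌈log₂1+2^n⌉≡1+n j) (ℕ.⌈log₂⌉-mono-≤ 2^j<n)

n<2^n : ∀ n → n ℕ.< 2 ℕ.^ n
n<2^n zero    = ℕ.s≤s ℕ.z≤n
n<2^n (suc n) = ℕ.+-mono-≤-< (ℕ.m^n>0 2 n) (subst (n ℕ.<_) (sym (ℕ.+-identityʳ _)) (n<2^n n))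

dyadic-scale : ∀ {u P} → 1 ℕ.≤ u → u ℕ.≤ P → ∃[ j ] 2 ℕ.^ j ℕ.* u ℕ.≤ P × P ℕ.< 2 ℕ.^ suc j ℕ.* u
dyadic-scale {u} {P} 1≤u u≤P = search P u≤P (ℕ.<-≤-trans (n<2^n P) (ℕ.m≤m*n (2 ℕ.^ P) u {{ℕ.>-nonZero 1≤u}}))
  where
  2^j*[2*v] : ∀ j v → 2 ℕ.^ j ℕ.* (2 ℕ.* v) ≡ 2 ℕ.^ suc j ℕ.* v
  2^j*[2*v] j v = trans (sym (ℕ.*-assoc (2 ℕ.^ j) 2 v)) (cong (ℕ._* v) (ℕ.*-comm (2 ℕ.^ j) 2))
  search : ∀ {v} n → v ℕ.≤ P → P ℕ.< 2 ℕ.^ n ℕ.* v → ∃[ j ] 2 ℕ.^ j ℕ.* v ℕ.≤ P × P ℕ.< 2 ℕ.^ suc j ℕ.* v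
  search {v} zero    v≤P P<v = ⊥-elim (ℕ.<-irrefl refl (ℕ.<-≤-trans (subst (P ℕ.<_) (ℕ.*-identityˡ v) P<v) v≤P))
  search {v} (suc n) v≤P P<2^[1+n]v with P ℕ.<? 2 ℕ.* v
  ... | yes P<2v = 0 , subst (ℕ._≤ P) (sym (ℕ.*-identityˡ v)) v≤P , P<2v
  ... | no  P≮2v =
    let j , lower , upper = search n (ℕ.≮⇒≥ P≮2v) (subst (P ℕ.<_) (sym (2^j*[2*v] n v)) P<2^[1+n]v)
    in suc j , subst (ℕ._≤ P) (2^j*[2*v] j v) lower , subst (P ℕ.<_) (2^j*[2*v] (suc j) v) upper

>⇒≤ᵇ≡false : ∀ {x y} → y ℕ.< x → (x ℕ.≤ᵇ y) ≡ false
>⇒≤ᵇ≡false {x} {y} y<x with x ℕ.≤ᵇ y in le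
... | false = refl
... | true  = ⊥-elim (ℕ.<⇒≱ y<x (ℕ.≤ᵇ⇒≤ x y (Equivalence.from Bool.T-≡ le)))

residue-class-bound : ∀ {p x P b} → 2 ℕ.* p ℕ.* x ℕ.< P ℕ.+ (2 ℕ.* p ℕ.+ 2 ℕ.* p) → P ℕ.< p ℕ.* b → x ℕ.≤ suc b
residue-class-bound {p} {x} {P} {b} 2px<P+4p P<pb with x ℕ.≤? suc b
... | yes x≤1+b = x≤1+b
... | no  x≰1+b = ⊥-elim (ℕ.<-irrefl refl (ℕ.<-≤-trans 2x<b+4 b+4≤2x))
  where
  open ℕ.≤-Reasoning
  2x<b+4 : 2 ℕ.* x ℕ.< b ℕ.+ 4
  2x<b+4 = ℕ.*-cancelˡ-< p _ _ (begin-strict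
    p ℕ.* (2 ℕ.* x)                  ≡⟨ sym (trans (cong (ℕ._* x) (ℕ.*-comm 2 p)) (ℕ.*-assoc p 2 x)) ⟩
    2 ℕ.* p ℕ.* x                    <⟨ ℕ.<-trans 2px<P+4p (ℕ.+-monoˡ-< _ P<pb) ⟩
    p ℕ.* b ℕ.+ (2 ℕ.* p ℕ.+ 2 ℕ.* p) ≡⟨ cong (p ℕ.* b ℕ.+_) (trans (sym (ℕ.*-distribʳ-+ p 2 2)) (ℕ.*-comm 4 p)) ⟩
    p ℕ.* b ℕ.+ p ℕ.* 4              ≡⟨ sym (ℕ.*-distribˡ-+ p b 4) ⟩
    p ℕ.* (b ℕ.+ 4)                  ∎)
  b+4≤2x : b ℕ.+ 4 ℕ.≤ 2 ℕ.* x
  b+4≤2x = begin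
    b ℕ.+ 4          ≡⟨ ℕ.+-comm b 4 ⟩
    4 ℕ.+ b          ≤⟨ ℕ.+-monoʳ-≤ 4 (ℕ.m≤n*m b 2) ⟩
    4 ℕ.+ 2 ℕ.* b    ≡⟨ sym (ℕ.*-distribˡ-+ 2 2 b) ⟩
    2 ℕ.* (2 ℕ.+ b)  ≤⟨ ℕ.*-monoʳ-≤ 2 (ℕ.≰⇒> x≰1+b) ⟩
    2 ℕ.* x          ∎

combine-injectiveʳ : ∀ {a b} (i : Fin a) {x y : Fin b} → combine i x ≡ combine i y → x ≡ y
combine-injectiveʳ {a} {b} i {x} {y} eq =
  cong proj₂ (trans (sym (Fin.remQuot-combine i x)) (trans (cong (remQuot b) eq) (Fin.remQuot-combine i y)))

default≤maxFin : ∀ k (g : Fin k → ℚ) d → d ≤ maxFin k g d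
default≤maxFin zero    g d = ℚ.≤-refl
default≤maxFin (suc k) g d = ℚ.≤-trans (default≤maxFin k (g ∘ suc) d) (ℚ.p≤q⊔p (g zero) _)

term≤maxFin : ∀ k (g : Fin k → ℚ) d i → g i ≤ maxFin k g d
term≤maxFin (suc k) g d zero    = ℚ.p≤p⊔q (g zero) _
term≤maxFin (suc k) g d (suc i) = ℚ.≤-trans (term≤maxFin k (g ∘ suc) d i) (ℚ.p≤q⊔p (g zero) _)

½^_ : ℕ → ℚ
½^ zero  = 1ℚ
½^ suc k = ½ * ½^ k

½^-nonNeg : ∀ k → 0ℚ ≤ ½^ k
½^-nonNeg zero    = ℚ.≤ᵇ⇒≤ tt
½^-nonNeg (suc k) = *-nonNeg 0≤½ (½^-nonNeg k)

½^k*2^k≡1 : ∀ k → ½^ k * ℕ→ℚ (2 ℕ.^ k) ≡ 1ℚ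
½^k*2^k≡1 zero    = refl
½^k*2^k≡1 (suc k) rewrite ℕ→ℚ-* 2 (2 ℕ.^ k) =
  trans (solve 2 (λ h x → (con ½ :* h) :* (con (ℕ→ℚ 2) :* x) := h :* x) refl (½^ k) (ℕ→ℚ (2 ℕ.^ k))) (½^k*2^k≡1 k)

sumList-unique : ∀ {A : Set} {g : List A → ℚ} (h : A → ℚ) → g [] ≡ 0ℚ → (∀ x xs → g (x ∷ xs) ≡ h x + g xs) →
  ∀ xs → g xs ≡ sumList xs h
sumList-unique h g[] g∷ []       = g[]
sumList-unique h g[] g∷ (x ∷ xs) = trans (g∷ x xs) (cong (λ s → h x + s) (sumList-unique h g[] g∷ xs))

module Analysis (I : Instance) where
  open Instance I hiding (ℕ→ℚ)
  open SingleDensity I using (L; Θ; N; Fjθ; Frand; candRev; algRev)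
  open FareFunction fare using (f)
  open FareFunctionProperties fare

  -- rev sums over commodities through an unnameable local helper; abstracting commodities
  -- turns it into a variable, so that unification can recover the helper for sumList-unique.
  rev≡sumList : ∀ F → rev F ≡ sumList commodities (λ c → rev-i c F)
  rev≡sumList F with commodities | sumList-unique (λ c → rev-i c F) refl (λ _ _ → refl)
  ... | cs | rev≡ = rev≡ cs

  -- j : Fin L stands for the class j + 1 of the paper, whose offsets θ are taken modulo 2^(j+2).
  modulus : Fin L → ℕ
  modulus j = 2 ℕ.^ suc (suc (toℕ j))

  modulus≤Θ : ∀ j → modulus j ℕ.≤ Θ
  modulus≤Θ j = ℕ.^-monoʳ-≤ 2 (ℕ.s≤s (Fin.toℕ<n j))

  weight : Fin L → Fin Θ → ℚ
  weight j θ = 𝟙 (toℕ θ ℕ.<ᵇ modulus j) * ½^ suc (suc (toℕ j))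

  weight-nonNeg : ∀ j θ → 0ℚ ≤ weight j θ
  weight-nonNeg j θ = *-nonNeg (𝟙-nonNeg (toℕ θ ℕ.<ᵇ modulus j)) (½^-nonNeg (suc (suc (toℕ j))))

  weights-sum-to-1 : ∀ j → sumFin Θ (weight j) ≡ 1ℚ
  weights-sum-to-1 j = begin
      sumFin Θ (weight j)                      ≡⟨ sumFin-cong Θ (λ θ → ℚ.*-comm (below θ) h) ⟩
      sumFin Θ (λ θ → h * below θ)             ≡⟨ sumFin-*ˡ Θ h below ⟩
      h * sumFin Θ below                       ≡⟨ cong (h *_) (sum-below Θ (modulus j) (modulus≤Θ j)) ⟩
      h * ℕ→ℚ (modulus j)                      ≡⟨ ½^k*2^k≡1 (suc (suc (toℕ j))) ⟩
      1ℚ                                       ∎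
    where
    open ≡-Reasoning
    h : ℚ
    h = ½^ suc (suc (toℕ j))
    below : Fin Θ → ℚ
    below θ = 𝟙 (toℕ θ ℕ.<ᵇ modulus j)

  classRev : Commodity m → (Fin N → Bool) → Fin L → ℚ
  classRev c ω j = sumFin Θ (λ θ → weight j θ * rev-i c (Frand ω j θ))

  mixedRev : Commodity m → (Fin N → Bool) → ℚ
  mixedRev c ω = rev-i c ∅ + sumFin L (classRev c ω)

  module PerCommodity (c : Commodity m) where
    open Commodity c using (u; w)

    load : EdgeSet m → ℕ
    load G = count (P c ∩ G)

    ū : ℕ
    ū = u ℕ.⊓ count (P c)

    peak : ℚ
    peak = ℕ→ℚ w * f ū

    peak-nonNeg : 0ℚ ≤ peak
    peak-nonNeg = *-nonNeg (ℕ→ℚ-nonNeg w) (f-nonNeg ū)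

    rev-i-feasible : ∀ G → load G ℕ.≤ u → rev-i c G ≡ ℕ→ℚ w * f (load G)
    rev-i-feasible G l≤u rewrite Equivalence.to Bool.T-≡ (ℕ.≤⇒≤ᵇ l≤u) = refl

    rev-i-overloaded : ∀ G → u ℕ.< load G → rev-i c G ≡ 0ℚ
    rev-i-overloaded G u<l rewrite >⇒≤ᵇ≡false u<l = refl

    rev-i-nonNeg : ∀ G → 0ℚ ≤ rev-i c G
    rev-i-nonNeg G = [ feasible , overloaded ]′ (ℕ.≤-<-connex (load G) u)
      where
      feasible : load G ℕ.≤ u → 0ℚ ≤ rev-i c G
      feasible l≤u = subst (0ℚ ≤_) (sym (rev-i-feasible G l≤u)) (*-nonNeg (ℕ→ℚ-nonNeg w) (f-nonNeg (load G)))
      overloaded : u ℕ.< load G → 0ℚ ≤ rev-i c G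
      overloaded u<l = ℚ.≤-reflexive (sym (rev-i-overloaded G u<l))

    rev-i≤peak : ∀ G → rev-i c G ≤ peak
    rev-i≤peak G = [ feasible , overloaded ]′ (ℕ.≤-<-connex (load G) u)
      where
      feasible : load G ℕ.≤ u → rev-i c G ≤ peak
      feasible l≤u = subst (_≤ peak) (sym (rev-i-feasible G l≤u))
                       (*-monoˡ-≤ (ℕ→ℚ-nonNeg w) (f-mono-≤ (ℕ.⊓-glb l≤u (count-∩-≤ (P c) G))))
      overloaded : u ℕ.< load G → rev-i c G ≤ peak
      overloaded u<l = subst (_≤ peak) (sym (rev-i-overloaded G u<l)) peak-nonNeg

    peak*load≤ū*rev-i : ∀ G → load G ℕ.≤ u → peak * ℕ→ℚ (load G) ≤ ℕ→ℚ ū * rev-i c G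
    peak*load≤ū*rev-i G l≤u = begin
        peak * ℕ→ℚ (load G)                    ≡⟨ solve 3 (λ w f l → (w :* f) :* l := w :* (l :* f)) refl (ℕ→ℚ w) (f ū) _ ⟩
        ℕ→ℚ w * (ℕ→ℚ (load G) * f ū)          ≤⟨ *-monoˡ-≤ (ℕ→ℚ-nonNeg w) (ratio-antitone (ℕ.⊓-glb l≤u (count-∩-≤ (P c) G))) ⟩
        ℕ→ℚ w * (ℕ→ℚ ū * f (load G))          ≡⟨ solve 3 (λ w u f → w :* (u :* f) := u :* (w :* f)) refl (ℕ→ℚ w) (ℕ→ℚ ū) _ ⟩
        ℕ→ℚ ū * (ℕ→ℚ w * f (load G))          ≡⟨ cong (ℕ→ℚ ū *_) (sym (rev-i-feasible G l≤u)) ⟩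
        ℕ→ℚ ū * rev-i c G                      ∎
      where open ℚ.≤-Reasoning

    module Class (j : Fin L) (θ : Fin Θ) where
      S : EdgeSet m
      S = P c ∩ Fjθ (suc (toℕ j)) (toℕ θ)

      X : ℕ
      X = count S

      coin : Fin m → Fin N
      coin = combine (combine j θ)

      K : (Fin N → Bool) → ℕ
      K ω = load (Frand ω j θ)

      R : (Fin N → Bool) → ℚ
      R ω = rev-i c (Frand ω j θ)

      K≡ : ∀ ω → K ω ≡ count (S ∩ (ω ∘ coin))
      K≡ ω = count-cong (λ e → sym (Bool.∧-assoc (P c e) _ (ω (coin e))))

      K≤X : ∀ ω → K ω ℕ.≤ X
      K≤X ω = subst (ℕ._≤ X) (sym (K≡ ω)) (count-∩-≤ S (ω ∘ coin))

      expect-peak*K : expect N (λ ω → peak * ℕ→ℚ (K ω)) ≡ peak * (ℕ→ℚ X * ½)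
      expect-peak*K = trans (expect-*ˡ N peak (ℕ→ℚ ∘ K))
        (cong (peak *_) (trans (expect-cong N (cong ℕ→ℚ ∘ K≡)) (expect-count-thinned N S coin)))

      feasible : X ℕ.≤ u → peak * ℕ→ℚ X ≤ ℕ→ℚ 4 * (ℕ→ℚ ū * expect N R)
      feasible X≤u = begin
          peak * ℕ→ℚ X
        ≤⟨ p≤p+q (*-nonNeg peak-nonNeg (ℕ→ℚ-nonNeg X)) ⟩
          peak * ℕ→ℚ X + peak * ℕ→ℚ X
        ≡⟨ solve 2 (λ a x → a :* x :+ a :* x := con (ℕ→ℚ 4) :* (a :* (x :* con ½))) refl peak (ℕ→ℚ X) ⟩
          ℕ→ℚ 4 * (peak * (ℕ→ℚ X * ½))
        ≡⟨ cong (ℕ→ℚ 4 *_) (sym expect-peak*K) ⟩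
          ℕ→ℚ 4 * expect N (λ ω → peak * ℕ→ℚ (K ω))
        ≤⟨ *-monoˡ-≤ (ℕ→ℚ-nonNeg 4) (expect-mono N (λ ω → peak*load≤ū*rev-i _ (ℕ.≤-trans (K≤X ω) X≤u))) ⟩
          ℕ→ℚ 4 * expect N (λ ω → ℕ→ℚ ū * R ω)
        ≡⟨ cong (ℕ→ℚ 4 *_) (expect-*ˡ N (ℕ→ℚ ū) R) ⟩
          ℕ→ℚ 4 * (ℕ→ℚ ū * expect N R)
        ∎
        where open ℚ.≤-Reasoning

      keeps-both : Fin m → Fin m → (Fin N → Bool) → ℚ
      keeps-both e₁ e₂ ω = 𝟙 (ω (coin e₁) ∧ ω (coin e₂))

      -- An overloaded draw keeps all of S, in particular the two edges e₁ and e₂.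
      draw-bound : ∀ {e₁ e₂} → S e₁ ≡ true → S e₂ ≡ true → X ≡ suc u → ∀ ω →
        peak * ℕ→ℚ (K ω) ≤ ℕ→ℚ ū * R ω + peak * ℕ→ℚ X * keeps-both e₁ e₂ ω
      draw-bound {e₁} {e₂} Se₁ Se₂ X≡1+u ω = [ feasible-draw , overloaded-draw ]′ (ℕ.≤-<-connex (K ω) u)
        where
        feasible-draw : K ω ℕ.≤ u → peak * ℕ→ℚ (K ω) ≤ ℕ→ℚ ū * R ω + peak * ℕ→ℚ X * keeps-both e₁ e₂ ω
        feasible-draw K≤u = ℚ.≤-trans (peak*load≤ū*rev-i _ K≤u)
          (p≤p+q (*-nonNeg (*-nonNeg peak-nonNeg (ℕ→ℚ-nonNeg X)) (𝟙-nonNeg (ω (coin e₁) ∧ ω (coin e₂)))))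
        overloaded-draw : u ℕ.< K ω → peak * ℕ→ℚ (K ω) ≤ ℕ→ℚ ū * R ω + peak * ℕ→ℚ X * keeps-both e₁ e₂ ω
        overloaded-draw u<K = ℚ.≤-reflexive (begin
            peak * ℕ→ℚ (K ω)                                ≡⟨ cong (λ k → peak * ℕ→ℚ k) K≡X ⟩
            peak * ℕ→ℚ X                                    ≡⟨ solve 2 (λ u x → x := u :* con 0ℚ :+ x :* con 1ℚ) refl (ℕ→ℚ ū) (peak * ℕ→ℚ X) ⟩
            ℕ→ℚ ū * 0ℚ + peak * ℕ→ℚ X * 1ℚ                  ≡⟨ cong₂ (λ r b → ℕ→ℚ ū * r + peak * ℕ→ℚ X * 𝟙 b)
                                                                 (sym (rev-i-overloaded _ u<K))
                                                                 (sym (cong₂ _∧_ (kept Se₁) (kept Se₂))) ⟩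
            ℕ→ℚ ū * R ω + peak * ℕ→ℚ X * keeps-both e₁ e₂ ω ∎)
          where
          open ≡-Reasoning
          K≡X : K ω ≡ X
          K≡X = ℕ.≤-antisym (K≤X ω) (subst (ℕ._≤ K ω) (sym X≡1+u) u<K)
          kept : ∀ {e} → S e ≡ true → ω (coin e) ≡ true
          kept = count-∩-full S (ω ∘ coin) (ℕ.≤-reflexive (trans (sym K≡X) (K≡ ω)))

      overloaded-via : ∀ {e₁ e₂} → e₁ ≢ e₂ → S e₁ ≡ true → S e₂ ≡ true → X ≡ suc u →
        peak * ℕ→ℚ X ≤ ℕ→ℚ 4 * (ℕ→ℚ ū * expect N R)
      overloaded-via {e₁} {e₂} e₁≢e₂ Se₁ Se₂ X≡1+u = +-cancelˡ-≤ peakX (begin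
          peakX + peakX
        ≡⟨ solve 1 (λ x → x :+ x := con (ℕ→ℚ 4) :* (x :* con ½)) refl peakX ⟩
          ℕ→ℚ 4 * (peakX * ½)
        ≡⟨ cong (ℕ→ℚ 4 *_) (trans (ℚ.*-assoc peak (ℕ→ℚ X) ½) (sym expect-peak*K)) ⟩
          ℕ→ℚ 4 * expect N (λ ω → peak * ℕ→ℚ (K ω))
        ≤⟨ *-monoˡ-≤ (ℕ→ℚ-nonNeg 4) (expect-mono N (draw-bound Se₁ Se₂ X≡1+u)) ⟩
          ℕ→ℚ 4 * expect N (λ ω → ℕ→ℚ ū * R ω + peakX * keeps-both e₁ e₂ ω)
        ≡⟨ cong (ℕ→ℚ 4 *_) (trans (expect-+ N _ _) (cong₂ _+_ (expect-*ˡ N (ℕ→ℚ ū) R)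
             (trans (expect-*ˡ N peakX (keeps-both e₁ e₂)) (cong (peakX *_) (expect-coin∧coin N coin₁≢coin₂))))) ⟩
          ℕ→ℚ 4 * (ℕ→ℚ ū * expect N R + peakX * (½ * ½))
        ≡⟨ solve 2 (λ x y → con (ℕ→ℚ 4) :* (y :+ x :* (con ½ :* con ½)) := x :+ con (ℕ→ℚ 4) :* y) refl peakX (ℕ→ℚ ū * expect N R) ⟩
          peakX + ℕ→ℚ 4 * (ℕ→ℚ ū * expect N R)
        ∎)
        where
        open ℚ.≤-Reasoning
        peakX : ℚ
        peakX = peak * ℕ→ℚ X
        coin₁≢coin₂ : coin e₁ ≢ coin e₂
        coin₁≢coin₂ = e₁≢e₂ ∘ combine-injectiveʳ (combine j θ)

      overloaded : u ℕ.< X → X ℕ.≤ suc ū → 1 ℕ.≤ ū → peak * ℕ→ℚ X ≤ ℕ→ℚ 4 * (ℕ→ℚ ū * expect N R)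
      overloaded u<X X≤1+ū 1≤ū =
        let e₁ , e₂ , e₁≢e₂ , Se₁ , Se₂ = two-members S (subst (2 ℕ.≤_) (sym X≡1+u) (ℕ.s≤s (ℕ.≤-trans 1≤ū ū≤u)))
        in overloaded-via e₁≢e₂ Se₁ Se₂ X≡1+u
        where
        ū≤u : ū ℕ.≤ u
        ū≤u = ℕ.m⊓n≤m u _
        X≡1+u : X ≡ suc u
        X≡1+u = ℕ.≤-antisym (ℕ.≤-trans X≤1+ū (ℕ.s≤s ū≤u)) u<X

      class-bound : X ℕ.≤ suc ū → 1 ℕ.≤ ū → peak * ℕ→ℚ X ≤ ℕ→ℚ 4 * (ℕ→ℚ ū * expect N R)
      class-bound X≤1+ū 1≤ū = [ feasible , (λ u<X → overloaded u<X X≤1+ū 1≤ū) ]′ (ℕ.≤-<-connex X u)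

  candRev≤algRev : ∀ ω j θ → candRev ω j θ ≤ algRev ω
  candRev≤algRev ω j θ = ℚ.≤-trans (term≤maxFin Θ (candRev ω j) (rev ∅) θ)
    (term≤maxFin L (λ j′ → maxFin Θ (candRev ω j′) (rev ∅)) (rev ∅) j)

  weighted-rev≤ : ∀ ω j θ → weight j θ * rev (Frand ω j θ) ≤ weight j θ * algRev ω
  weighted-rev≤ ω j θ = guarded (toℕ θ ℕ.<ᵇ modulus j) refl
    where
    h : ℚ
    h = ½^ suc (suc (toℕ j))
    guarded : ∀ b → (toℕ θ ℕ.<ᵇ modulus j) ≡ b → 𝟙 b * h * rev (Frand ω j θ) ≤ 𝟙 b * h * algRev ω
    guarded true  candidate = *-monoˡ-≤ (*-nonNeg (𝟙-nonNeg true) (½^-nonNeg (suc (suc (toℕ j)))))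
      (subst (_≤ algRev ω) (cong (λ b → if b then rev (Frand ω j θ) else rev ∅) candidate) (candRev≤algRev ω j θ))
    guarded false _ = ℚ.≤-reflexive (trans (zero-weight (rev (Frand ω j θ))) (sym (zero-weight (algRev ω))))
      where
      zero-weight : ∀ x → 0ℚ * h * x ≡ 0ℚ
      zero-weight x = trans (cong (_* x) (ℚ.*-zeroˡ h)) (ℚ.*-zeroˡ x)

  average-rev≤algRev : ∀ ω j → sumFin Θ (λ θ → weight j θ * rev (Frand ω j θ)) ≤ algRev ω
  average-rev≤algRev ω j = begin
      sumFin Θ (λ θ → weight j θ * rev (Frand ω j θ))  ≤⟨ sumFin-mono Θ (weighted-rev≤ ω j) ⟩
      sumFin Θ (λ θ → weight j θ * algRev ω)           ≡⟨ sumFin-cong Θ (λ θ → ℚ.*-comm (weight j θ) (algRev ω)) ⟩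
      sumFin Θ (λ θ → algRev ω * weight j θ)           ≡⟨ sumFin-*ˡ Θ (algRev ω) (weight j) ⟩
      algRev ω * sumFin Θ (weight j)                   ≡⟨ cong (algRev ω *_) (weights-sum-to-1 j) ⟩
      algRev ω * 1ℚ                                    ≡⟨ ℚ.*-identityʳ (algRev ω) ⟩
      algRev ω                                         ∎
    where open ℚ.≤-Reasoning

  sum-mixedRev : ∀ ω → sumList commodities (λ c → mixedRev c ω)
                       ≡ rev ∅ + sumFin L (λ j → sumFin Θ (λ θ → weight j θ * rev (Frand ω j θ)))
  sum-mixedRev ω = begin
      sumList cs (λ c → rev-i c ∅ + sumFin L (λ j → sumFin Θ (λ θ → weight j θ * rev-i c (Frand ω j θ))))
    ≡⟨ sumList-+ cs _ _ ⟩
      sumList cs (λ c → rev-i c ∅) + sumList cs (λ c → sumFin L (λ j → sumFin Θ (λ θ → weight j θ * rev-i c (Frand ω j θ))))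
    ≡⟨ cong₂ _+_ (sym (rev≡sumList ∅)) (sumList-sumFin cs L _) ⟩
      rev ∅ + sumFin L (λ j → sumList cs (λ c → sumFin Θ (λ θ → weight j θ * rev-i c (Frand ω j θ))))
    ≡⟨ cong (λ s → rev ∅ + s) (sumFin-cong L (λ j → sumList-sumFin cs Θ _)) ⟩
      rev ∅ + sumFin L (λ j → sumFin Θ (λ θ → sumList cs (λ c → weight j θ * rev-i c (Frand ω j θ))))
    ≡⟨ cong (λ s → rev ∅ + s) (sumFin-cong L (λ j → sumFin-cong Θ (λ θ →
         trans (sumList-*ˡ cs (weight j θ) _) (cong (weight j θ *_) (sym (rev≡sumList (Frand ω j θ))))))) ⟩
      rev ∅ + sumFin L (λ j → sumFin Θ (λ θ → weight j θ * rev (Frand ω j θ)))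
    ∎
    where
    open ≡-Reasoning
    cs = commodities

  sum-mixedRev≤ : ∀ ω → sumList commodities (λ c → mixedRev c ω) ≤ ℕ→ℚ (suc L) * algRev ω
  sum-mixedRev≤ ω = begin
      sumList commodities (λ c → mixedRev c ω)
    ≡⟨ sum-mixedRev ω ⟩
      rev ∅ + sumFin L (λ j → sumFin Θ (λ θ → weight j θ * rev (Frand ω j θ)))
    ≤⟨ ℚ.+-mono-≤ (default≤maxFin L _ (rev ∅)) (sumFin-mono L (average-rev≤algRev ω)) ⟩
      algRev ω + sumFin L (λ _ → algRev ω)
    ≡⟨ cong (λ s → algRev ω + s) (sumFin-const L (algRev ω)) ⟩
      algRev ω + ℕ→ℚ L * algRev ω
    ≡⟨ solve 2 (λ a l → a :+ l :* a := (con 1ℚ :+ l) :* a) refl (algRev ω) (ℕ→ℚ L) ⟩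
      (1ℚ + ℕ→ℚ L) * algRev ω
    ≡⟨ cong (_* algRev ω) (sym (ℕ→ℚ-+ 1 L)) ⟩
      ℕ→ℚ (suc L) * algRev ω
    ∎
    where open ℚ.≤-Reasoning

  module _ (c : Commodity m) where
    open PerCommodity c

    classAverage : Fin L → ℚ
    classAverage j = sumFin Θ (λ θ → weight j θ * expect N (Class.R j θ))

    classRev-nonNeg : ∀ ω j → 0ℚ ≤ classRev c ω j
    classRev-nonNeg ω j = sumFin-nonNeg Θ (λ θ → *-nonNeg (weight-nonNeg j θ) (rev-i-nonNeg _))

    rev-i-∅≤expect-mixedRev : rev-i c ∅ ≤ expect N (mixedRev c)
    rev-i-∅≤expect-mixedRev = subst (_≤ expect N (mixedRev c)) (expect-const N (rev-i c ∅))
      (expect-mono N (λ ω → p≤p+q (sumFin-nonNeg L (classRev-nonNeg ω))))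

    classAverage≤expect-mixedRev : ∀ j → classAverage j ≤ expect N (mixedRev c)
    classAverage≤expect-mixedRev j = begin
        sumFin Θ (λ θ → weight j θ * expect N (Class.R j θ))
      ≡⟨ sym (trans (expect-sumFin N Θ _) (sumFin-cong Θ (λ θ → expect-*ˡ N (weight j θ) (Class.R j θ)))) ⟩
        expect N (λ ω → classRev c ω j)
      ≤⟨ expect-mono N (λ ω → ℚ.≤-trans (term≤sumFin L (classRev-nonNeg ω) j) (p≤q+p (rev-i-nonNeg ∅))) ⟩
        expect N (mixedRev c)
      ∎
      where open ℚ.≤-Reasoning

    module Scale (j : Fin L) (1≤ū : 1 ℕ.≤ ū)
                 (lower : 2 ℕ.^ toℕ j ℕ.* ū ℕ.≤ count (P c))
                 (upper : count (P c) ℕ.< 2 ℕ.^ suc (toℕ j) ℕ.* ū) where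
      instance
        modulus-nonZero : ℕ.NonZero (modulus j)
        modulus-nonZero = ℕ.m^n≢0 2 (suc (suc (toℕ j)))

      below : Fin Θ → ℚ
      below θ = 𝟙 (toℕ θ ℕ.<ᵇ modulus j)

      E : Fin Θ → ℚ
      E θ = expect N (Class.R j θ)

      Σθ : ℚ
      Σθ = sumFin Θ (λ θ → below θ * E θ)

      X≤1+ū : ∀ θ → Class.X j θ ℕ.≤ suc ū
      X≤1+ū θ = residue-class-bound {2 ℕ.^ suc (toℕ j)} {Class.X j θ} {count (P c)} {ū}
        (path-residue-count tree (Commodity.src c) (Commodity.tgt c) (modulus j) (toℕ θ)) upper

      peak*|P|≤ : peak * ℕ→ℚ (count (P c)) ≤ (ℕ→ℚ 4 * ℕ→ℚ ū) * Σθ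
      peak*|P|≤ = begin
          peak * ℕ→ℚ (count (P c))
        ≡⟨ cong (peak *_) (sym (sum-residue-classes Θ (modulus j) (modulus≤Θ j) (P c) (dist tree))) ⟩
          peak * sumFin Θ (λ θ → below θ * ℕ→ℚ (Class.X j θ))
        ≡⟨ trans (sym (sumFin-*ˡ Θ peak (λ θ → below θ * ℕ→ℚ (Class.X j θ))))
                 (sumFin-cong Θ (λ θ → swap peak (below θ) (ℕ→ℚ (Class.X j θ)))) ⟩
          sumFin Θ (λ θ → below θ * (peak * ℕ→ℚ (Class.X j θ)))
        ≤⟨ sumFin-mono Θ (λ θ → *-monoˡ-≤ (𝟙-nonNeg (toℕ θ ℕ.<ᵇ modulus j)) (Class.class-bound j θ (X≤1+ū θ) 1≤ū)) ⟩
          sumFin Θ (λ θ → below θ * (ℕ→ℚ 4 * (ℕ→ℚ ū * E θ)))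
        ≡⟨ sumFin-cong Θ (λ θ → solve 4 (λ b f u e → b :* (f :* (u :* e)) := (f :* u) :* (b :* e)) refl (below θ) (ℕ→ℚ 4) (ℕ→ℚ ū) (E θ)) ⟩
          sumFin Θ (λ θ → (ℕ→ℚ 4 * ℕ→ℚ ū) * (below θ * E θ))
        ≡⟨ sumFin-*ˡ Θ (ℕ→ℚ 4 * ℕ→ℚ ū) _ ⟩
          (ℕ→ℚ 4 * ℕ→ℚ ū) * Σθ
        ∎
        where
        open ℚ.≤-Reasoning
        swap : ∀ a b x → a * (b * x) ≡ b * (a * x)
        swap = solve 3 (λ a b x → a :* (b :* x) := b :* (a :* x)) refl

      peak*2^j≤ : peak * ℕ→ℚ (2 ℕ.^ toℕ j) ≤ ℕ→ℚ 4 * Σθ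
      peak*2^j≤ = *-cancelˡ-≤-ℕ→ℚ ū 1≤ū (begin
          ℕ→ℚ ū * (peak * ℕ→ℚ (2 ℕ.^ toℕ j))
        ≡⟨ trans (solve 3 (λ u a p → u :* (a :* p) := a :* (p :* u)) refl (ℕ→ℚ ū) peak _)
                 (cong (peak *_) (sym (ℕ→ℚ-* (2 ℕ.^ toℕ j) ū))) ⟩
          peak * ℕ→ℚ (2 ℕ.^ toℕ j ℕ.* ū)
        ≤⟨ *-monoˡ-≤ peak-nonNeg (ℕ→ℚ-mono-≤ lower) ⟩
          peak * ℕ→ℚ (count (P c))
        ≤⟨ peak*|P|≤ ⟩
          (ℕ→ℚ 4 * ℕ→ℚ ū) * Σθ
        ≡⟨ solve 3 (λ f u s → (f :* u) :* s := u :* (f :* s)) refl (ℕ→ℚ 4) (ℕ→ℚ ū) Σθ ⟩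
          ℕ→ℚ ū * (ℕ→ℚ 4 * Σθ)
        ∎)
        where open ℚ.≤-Reasoning

      peak≤16*classAverage : peak ≤ ℕ→ℚ 16 * classAverage j
      peak≤16*classAverage = begin
          peak
        ≡⟨ sym (trans (cong (peak *_) (½^k*2^k≡1 (suc (suc (toℕ j))))) (ℚ.*-identityʳ peak)) ⟩
          peak * (h * ℕ→ℚ (modulus j))
        ≡⟨ cong (λ x → peak * (h * x)) (trans (cong ℕ→ℚ (sym (ℕ.*-assoc 2 2 (2 ℕ.^ toℕ j)))) (ℕ→ℚ-* 4 (2 ℕ.^ toℕ j))) ⟩
          peak * (h * (ℕ→ℚ 4 * ℕ→ℚ (2 ℕ.^ toℕ j)))
        ≡⟨ solve 4 (λ a h f p → a :* (h :* (f :* p)) := (f :* h) :* (a :* p)) refl peak h (ℕ→ℚ 4) (ℕ→ℚ (2 ℕ.^ toℕ j)) ⟩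
          (ℕ→ℚ 4 * h) * (peak * ℕ→ℚ (2 ℕ.^ toℕ j))
        ≤⟨ *-monoˡ-≤ (*-nonNeg (ℕ→ℚ-nonNeg 4) (½^-nonNeg (suc (suc (toℕ j))))) peak*2^j≤ ⟩
          (ℕ→ℚ 4 * h) * (ℕ→ℚ 4 * Σθ)
        ≡⟨ solve 3 (λ f h s → (f :* h) :* (f :* s) := (f :* f) :* (h :* s)) refl (ℕ→ℚ 4) h Σθ ⟩
          (ℕ→ℚ 4 * ℕ→ℚ 4) * (h * Σθ)
        ≡⟨ cong₂ _*_ (sym (ℕ→ℚ-* 4 4)) (sym (trans (sumFin-cong Θ (λ θ →
                                                    solve 3 (λ b h e → (b :* h) :* e := h :* (b :* e)) refl (below θ) h (E θ)))
                                                  (sumFin-*ˡ Θ h _))) ⟩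
          ℕ→ℚ 16 * classAverage j
        ∎
        where
        open ℚ.≤-Reasoning
        h : ℚ
        h = ½^ suc (suc (toℕ j))

    peak≤16*expect-mixedRev : peak ≤ ℕ→ℚ 16 * expect N (mixedRev c)
    peak≤16*expect-mixedRev = [ (λ ū≤0 → bound-ū≡0 (ℕ.n≤0⇒n≡0 ū≤0)) , bound-ū≥1 ]′ (ℕ.≤-<-connex ū 0)
      where
      bound-ū≡0 : ū ≡ 0 → peak ≤ ℕ→ℚ 16 * expect N (mixedRev c)
      bound-ū≡0 ū≡0 = ℚ.≤-trans (ℚ.≤-reflexive peak≡rev-i-∅) (ℚ.≤-trans rev-i-∅≤expect-mixedRev (x≤16x expect-nonNeg))
        where
        load-∅ : load ∅ ≡ 0
        load-∅ = count-∅ (P c ∩ ∅) (λ e → Bool.∧-zeroʳ (P c e))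
        peak≡rev-i-∅ : peak ≡ rev-i c ∅
        peak≡rev-i-∅ = trans (cong (λ x → ℕ→ℚ (Commodity.w c) * f x) (trans ū≡0 (sym load-∅)))
                             (sym (rev-i-feasible ∅ (subst (ℕ._≤ Commodity.u c) (sym load-∅) ℕ.z≤n)))
        expect-nonNeg : 0ℚ ≤ expect N (mixedRev c)
        expect-nonNeg = ℚ.≤-trans (rev-i-nonNeg ∅) rev-i-∅≤expect-mixedRev
        x≤16x : ∀ {x} → 0ℚ ≤ x → x ≤ ℕ→ℚ 16 * x
        x≤16x {x} 0≤x = subst (x ≤_) (solve 1 (λ x → x :+ con (ℕ→ℚ 15) :* x := con (ℕ→ℚ 16) :* x) refl x)
                          (p≤p+q (*-nonNeg (ℕ→ℚ-nonNeg 15) 0≤x))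
      bound-ū≥1 : 1 ℕ.≤ ū → peak ≤ ℕ→ℚ 16 * expect N (mixedRev c)
      bound-ū≥1 1≤ū =
        let jₙ , lower , upper = dyadic-scale 1≤ū (ℕ.m⊓n≤n (Commodity.u c) (count (P c)))
            jₙ<L = 2^j<n⇒j<⌈log₂n⌉ {jₙ} (ℕ.s≤s (ℕ.≤-trans (ℕ.≤-trans (ℕ.m≤m*n (2 ℕ.^ jₙ) ū {{ℕ.>-nonZero 1≤ū}}) lower) (count≤size (P c))))
            j = fromℕ< jₙ<L
            toℕj≡jₙ = Fin.toℕ-fromℕ< jₙ<L
        in ℚ.≤-trans
             (Scale.peak≤16*classAverage j 1≤ū
               (subst (λ i → 2 ℕ.^ i ℕ.* ū ℕ.≤ count (P c)) (sym toℕj≡jₙ) lower)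
               (subst (λ i → count (P c) ℕ.< 2 ℕ.^ suc i ℕ.* ū) (sym toℕj≡jₙ) upper))
             (*-monoˡ-≤ (ℕ→ℚ-nonNeg 16) (classAverage≤expect-mixedRev j))

  rev≤ : ∀ F → rev F ≤ ℕ→ℚ (16 ℕ.* suc L) * expect N algRev
  rev≤ F = begin
      rev F
    ≡⟨ rev≡sumList F ⟩
      sumList cs (λ c → rev-i c F)
    ≤⟨ sumList-mono cs (λ c → ℚ.≤-trans (PerCommodity.rev-i≤peak c F) (peak≤16*expect-mixedRev c)) ⟩
      sumList cs (λ c → ℕ→ℚ 16 * expect N (mixedRev c))
    ≡⟨ trans (sumList-*ˡ cs (ℕ→ℚ 16) _) (cong (ℕ→ℚ 16 *_) (sym (expect-sumList N cs mixedRev))) ⟩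
      ℕ→ℚ 16 * expect N (λ ω → sumList cs (λ c → mixedRev c ω))
    ≤⟨ *-monoˡ-≤ (ℕ→ℚ-nonNeg 16) (expect-mono N sum-mixedRev≤) ⟩
      ℕ→ℚ 16 * expect N (λ ω → ℕ→ℚ (suc L) * algRev ω)
    ≡⟨ cong (ℕ→ℚ 16 *_) (expect-*ˡ N (ℕ→ℚ (suc L)) algRev) ⟩
      ℕ→ℚ 16 * (ℕ→ℚ (suc L) * expect N algRev)
    ≡⟨ trans (sym (ℚ.*-assoc (ℕ→ℚ 16) (ℕ→ℚ (suc L)) (expect N algRev))) (cong (_* expect N algRev) (sym (ℕ→ℚ-* 16 (suc L)))) ⟩
      ℕ→ℚ (16 ℕ.* suc L) * expect N algRev
    ∎
    where
    open ℚ.≤-Reasoning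
    cs = commodities

theorem2 : Σ ℕ λ c → (I : Instance) → (F : EdgeSet (Instance.m I)) →
    Instance.rev I F ≤ ((+ (c *ℕ suc ⌈log₂ Instance.n I ⌉)) / 1) * SingleDensity.expectedAlgRev I
theorem2 = 16 , Analysis.rev≤
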